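{- (1) If $\mu$ and $\nu$ are hook shapes, then $\lambda(\mu,\nu)$ and $\rho(\mu,\nu)$ are hook shapes. (2) If $\mu$ and $\nu$ each have at most two nonzero parts, then so do $\lambda(\mu,\nu)$ and $\rho(\mu,\nu)$. (3) If $\alpha\subseteq\mu$, $\beta\subseteq\nu$ and $\mu/\alpha$, $\nu/\beta$ are horizontal strips, then $\lambda(\mu,\nu)/\lambda(\alpha,\beta)$ and $\rho(\mu,\nu)/\rho(\alpha,\beta)$ are horizontal strips. (4) If $\alpha\subseteq\mu$, $\beta\subseteq\nu$ and $\mu/\alpha$, $\nu/\beta$ are weak ribbons, then $\lambda(\mu,\nu)/\lambda(\alpha,\beta)$ and $\rho(\mu,\nu)/\rho(\alpha,\beta)$ are weak ribbons.
   Context: Partitions are weakly decreasing sequences of nonnegative integers, identified up to trailing zeros. For partitions $\mu,\nu$ written as $n$-tuples ($n\ge$ the number of nonzero parts of each), the $*$-operation is $(\mu,\nu)^*=(\lambda(\mu,\nu),\rho(\mu,\nu))$ with $\lambda_k=\mu_k-k+\#\{j\in\{1,\dots,n\}: \nu_j-j\ge \mu_k-k\}$ and $\rho_j=\nu_j-j+1+\#\{k\in\{1,\dots,n\}:\mu_k-k>\nu_j-j\}$; if $\alpha\subseteq\mu,\beta\subseteq\nu$ then $\lambda(\alpha,\beta)\subseteq\lambda(\mu,\nu)$ and $\rho(\alpha,\beta)\subseteq\rho(\mu,\nu)$. A hook shape is a partition $\mu$ with $\mu_2\le1$. A skew shape $\mu/\alpha$ is a horizontal strip if no two of its cells lie in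 the same column (equivalently $\alpha_k\ge\mu_{k+1}$ for all $k$), and a weak ribbon if it contains no $2\times2$ square of cells (equivalently $\mu_{k+1}\le\alpha_k+1$ for all $k$). -}

module Defs where

open import Data.Nat as ℕ using (ℕ; suc)
open import Data.Integer as ℤ using (ℤ; +_; _-_; _≤?_; _<?_)
open import Data.Fin using (Fin; toℕ)
open import Data.List using (length; filter; allFin)
open import Data.Product using (_×_)
open import Relation.Binary.PropositionalEquality using (_≡_)

-- A partition written as an n-tuple (μ_1,…,μ_n); index i : Fin n stands for
-- the 1-based position k = toℕ i + 1.
Tuple : ℕ → Set
Tuple n = Fin n → ℕ

IsPartition : ∀ {n} → Tuple n → Set
IsPartition {n} μ = ∀ (i j : Fin n) → toℕ i ℕ.≤ toℕ j → μ j ℕ.≤ μ i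

shifted : ∀ {n} → Tuple n → Fin n → ℤ
shifted μ i = + μ i - + suc (toℕ i)

lam : ∀ {n} → Tuple n → Tuple n → Fin n → ℤ
lam {n} μ ν k =
  shifted μ k ℤ.+ + length (filter (λ j → shifted μ k ≤? shifted ν j) (allFin n))

rho : ∀ {n} → Tuple n → Tuple n → Fin n → ℤ
rho {n} μ ν j =
  shifted ν j ℤ.+ + 1 ℤ.+ + length (filter (λ k → shifted ν j <? shifted μ k) (allFin n))

-- ℕ-valued tuples
-- hook shape: μ_2 ≤ 1 (vacuous if n < 2)
IsHook : ∀ {n} → Tuple n → Set
IsHook {n} μ = ∀ (i : Fin n) → toℕ i ≡ 1 → μ i ℕ.≤ 1

AtMostTwoParts : ∀ {n} → Tuple n → Set
AtMostTwoParts {n} μ = ∀ (i : Fin n) → 2 ℕ.≤ toℕ i → μ i ≡ 0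

_⊆ₚ_ : ∀ {n} → Tuple n → Tuple n → Set
_⊆ₚ_ {n} α μ = ∀ (i : Fin n) → α i ℕ.≤ μ i

-- μ/α horizontal strip: α_k ≥ μ_{k+1} for all k (μ_{n+1} = 0)
HorizontalStrip : ∀ {n} → Tuple n → Tuple n → Set
HorizontalStrip {n} μ α = ∀ (i j : Fin n) → toℕ j ≡ suc (toℕ i) → μ j ℕ.≤ α i

WeakRibbon : ∀ {n} → Tuple n → Tuple n → Set
WeakRibbon {n} μ α = ∀ (i j : Fin n) → toℕ j ≡ suc (toℕ i) → μ j ℕ.≤ suc (α i)

IsHookℤ : ∀ {n} → (Fin n → ℤ) → Set
IsHookℤ {n} μ = ∀ (i : Fin n) → toℕ i ≡ 1 → μ i ℤ.≤ + 1

AtMostTwoPartsℤ : ∀ {n} → (Fin n → ℤ) → Set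
AtMostTwoPartsℤ {n} μ = ∀ (i : Fin n) → 2 ℕ.≤ toℕ i → μ i ≡ + 0

HorizontalStripℤ : ∀ {n} → (Fin n → ℤ) → (Fin n → ℤ) → Set
HorizontalStripℤ {n} μ α = ∀ (i j : Fin n) → toℕ j ≡ suc (toℕ i) → μ j ℤ.≤ α i

WeakRibbonℤ : ∀ {n} → (Fin n → ℤ) → (Fin n → ℤ) → Set
WeakRibbonℤ {n} μ α = ∀ (i j : Fin n) → toℕ j ≡ suc (toℕ i) → μ j ℤ.≤ α i ℤ.+ + 1

{-# OPTIONS --safe #-}
-- Write c_j = ν_j − j and d_k = μ_k − k; both are strictly decreasing, and
-- λ_k = bump c d_k, ρ_j = bump d (c_j + 1), where bump c x = x + #{j : x ≤ c_j}.
-- If c_{j+1} < c′_j for all j, the indices counted for c at x, shifted down by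
-- one, are counted for c′ at x + 1, so bump c x ≤ bump c′ (x + 1); with c′ = c
-- this makes bump c monotone. If only c_{j+1} ≤ c′_j, the same shift gives
-- bump c x ≤ bump c′ x + 1. Horizontal strips and weak ribbons are exactly these
-- two interlacing conditions on the shifted sequences, which gives (3) and (4).
-- For hooks and shapes with at most two rows the count is explicit.
module Submission where

open import Defs
open import Data.Fin as Fin using (Fin; toℕ; fromℕ<; inject₁)
open import Data.Fin.Properties using (toℕ<n; toℕ-fromℕ<; toℕ-inject₁)
open import Data.Integer as ℤ
  using (ℤ; +_; _+_; _-_; _≤_; _<_; _≤?_; _<?_; +≤+; +<+; 1ℤ)
  renaming (suc to sucℤ)
import Data.Integer.Properties as ℤP
open import Algebra.Properties.AbelianGroup ℤP.+-0-abelianGroup using (//-rightDividesˡ)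
open import Data.List using (length; filter; tabulate)
open import Data.List.Properties using (filter-≐)
open import Data.Nat as ℕ using (ℕ; zero; suc; z≤n; s≤s)
import Data.Nat.Properties as ℕP
open import Data.Product using (_×_; _,_)
open import Function using (id; _∘_)
open import Level using (Level)
open import Relation.Binary.Core using (Rel)
open import Relation.Binary.PropositionalEquality
  using (_≡_; sym; trans; cong; cong₂; subst; subst₂; module ≡-Reasoning)
open import Relation.Nullary using (¬_; yes; no; contradiction)
open import Relation.Unary using (Pred; Decidable)

private
  variable
    a p q ℓ : Level
    A : Set a

count : {P : Pred A p} → Decidable P → ∀ {n} → (Fin n → A) → ℕ
count P? f = length (filter P? (tabulate f))

module _ {P : Pred A p} (P? : Decidable P) where

  count-≤ : ∀ {n m} (f : Fin n → A) →
            (∀ i → m ℕ.≤ toℕ i → ¬ P (f i)) → count P? f ℕ.≤ m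
  count-≤ {zero} f _ = z≤n
  count-≤ {suc n} {zero} f none with P? (f Fin.zero)
  ... | yes p = contradiction p (none Fin.zero z≤n)
  ... | no _  = count-≤ (f ∘ Fin.suc) (λ i _ → none (Fin.suc i) z≤n)
  count-≤ {suc n} {suc m} f none with P? (f Fin.zero)
  ... | yes _ = s≤s (count-≤ (f ∘ Fin.suc) (λ i → none (Fin.suc i) ∘ s≤s))
  ... | no _  = ℕP.m≤n⇒m≤1+n (count-≤ (f ∘ Fin.suc) (λ i → none (Fin.suc i) ∘ s≤s))

  count-≥ : ∀ {n m} (f : Fin n → A) → m ℕ.≤ n →
            (∀ i → toℕ i ℕ.< m → P (f i)) → m ℕ.≤ count P? f
  count-≥ {m = zero} f _ _ = z≤n
  count-≥ {m = suc m} f (s≤s m≤n) prefix with P? (f Fin.zero)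
  ... | yes _ = s≤s (count-≥ (f ∘ Fin.suc) m≤n (λ i → prefix (Fin.suc i) ∘ s≤s))
  ... | no ¬p = contradiction (prefix Fin.zero (s≤s z≤n)) ¬p

  count-≤-suc-tail : ∀ {n} (f : Fin (suc n) → A) →
                     count P? f ℕ.≤ suc (count P? (f ∘ Fin.suc))
  count-≤-suc-tail f with P? (f Fin.zero)
  ... | yes _ = ℕP.≤-refl
  ... | no _  = ℕP.n≤1+n _

module _ {P : Pred A p} {Q : Pred A q} (P? : Decidable P) (Q? : Decidable Q) where

  count-mono-inject₁ : ∀ {n} (f : Fin n → A) (g : Fin (suc n) → A) →
                       (∀ i → P (f i) → Q (g (inject₁ i))) → count P? f ℕ.≤ count Q? g
  count-mono-inject₁ {zero} _ _ _ = z≤n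
  count-mono-inject₁ {suc n} f g imp
    with ih ← count-mono-inject₁ (f ∘ Fin.suc) (g ∘ Fin.suc) (imp ∘ Fin.suc)
       | P? (f Fin.zero) | Q? (g Fin.zero)
  ... | yes _ | yes _ = s≤s ih
  ... | yes p | no ¬q = contradiction (imp Fin.zero p) ¬q
  ... | no _  | yes _ = ℕP.m≤n⇒m≤1+n ih
  ... | no _  | no _  = ih

  count-shift : ∀ {n} (f g : Fin n → A) →
                (∀ i j → toℕ j ≡ suc (toℕ i) → P (f j) → Q (g i)) →
                count P? f ℕ.≤ suc (count Q? g)
  count-shift {zero} _ _ _ = z≤n
  count-shift {suc n} f g next = ℕP.≤-trans (count-≤-suc-tail P? f)
    (s≤s (count-mono-inject₁ (f ∘ Fin.suc) g
      (λ i → next (inject₁ i) (Fin.suc i) (cong suc (sym (toℕ-inject₁ i))))))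

Stepwise : Rel A ℓ → ∀ {n} → (Fin n → A) → (Fin n → A) → Set ℓ
Stepwise R {n} c c′ = ∀ (i j : Fin n) → toℕ j ≡ suc (toℕ i) → R (c j) (c′ i)

≤-suc⇒monotone : {f : ℤ → ℤ} → (∀ x → f x ≤ f (sucℤ x)) →
                 ∀ {x y} → x ≤ y → f x ≤ f y
≤-suc⇒monotone {f} step {x} {y} x≤y = subst (λ v → f x ≤ f v) y-x+x≡y (climb ℤ.∣ y - x ∣)
  where
  climb : ∀ d → f x ≤ f (+ d + x)
  climb zero = ℤP.≤-reflexive (cong f (sym (ℤP.+-identityˡ x)))
  climb (suc d) = ℤP.≤-trans (climb d)
    (subst (λ v → f (+ d + x) ≤ f v) (sym (ℤP.+-assoc 1ℤ (+ d) x)) (step (+ d + x)))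
  y-x+x≡y : + ℤ.∣ y - x ∣ + x ≡ y
  y-x+x≡y = trans (cong (_+ x) (ℤP.0≤i⇒+∣i∣≡i (ℤP.i≤j⇒0≤j-i x≤y))) (//-rightDividesˡ x y)

bump : ∀ {n} → (Fin n → ℤ) → ℤ → ℤ
bump c x = x + + count (λ j → x ≤? c j) id

module _ {n} {c c′ : Fin n → ℤ} where

  bump-≤-bump-suc : Stepwise _<_ c c′ → ∀ x → bump c x ≤ bump c′ (sucℤ x)
  bump-≤-bump-suc c<c′ x = begin
    x + + count (λ j → x ≤? c j) id  ≤⟨ ℤP.+-monoʳ-≤ x (+≤+ counts) ⟩
    x + (1ℤ + + k)                   ≡⟨ sym (ℤP.+-assoc x 1ℤ (+ k)) ⟩
    (x + 1ℤ) + + k                   ≡⟨ cong (_+ + k) (ℤP.+-comm x 1ℤ) ⟩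
    bump c′ (sucℤ x)                 ∎
    where
    open ℤP.≤-Reasoning
    k = count (λ j → sucℤ x ≤? c′ j) id
    counts = count-shift (λ j → x ≤? c j) (λ j → sucℤ x ≤? c′ j) id id
      (λ i j j≡1+i x≤cⱼ → ℤP.i<j⇒suc[i]≤j (ℤP.≤-<-trans x≤cⱼ (c<c′ i j j≡1+i)))

  bump-≤-bump+1 : Stepwise _≤_ c c′ → ∀ x → bump c x ≤ bump c′ x + 1ℤ
  bump-≤-bump+1 c≤c′ x = begin
    x + + count (λ j → x ≤? c j) id  ≤⟨ ℤP.+-monoʳ-≤ x (+≤+ counts) ⟩
    x + (1ℤ + + k)                   ≡⟨ cong (λ y → x + y) (ℤP.+-comm 1ℤ (+ k)) ⟩
    x + (+ k + 1ℤ)                   ≡⟨ sym (ℤP.+-assoc x (+ k) 1ℤ) ⟩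
    bump c′ x + 1ℤ                   ∎
    where
    open ℤP.≤-Reasoning
    k = count (λ j → x ≤? c′ j) id
    counts = count-shift (λ j → x ≤? c j) (λ j → x ≤? c′ j) id id
      (λ i j j≡1+i x≤cⱼ → ℤP.≤-trans x≤cⱼ (c≤c′ i j j≡1+i))

module _ {n} {c : Fin n → ℤ} where

  bump-mono : Stepwise _<_ c c → ∀ {x y} → x ≤ y → bump c x ≤ bump c y
  bump-mono c↓ = ≤-suc⇒monotone (bump-≤-bump-suc c↓)

  bump-≤ : ∀ {x m} → (∀ j → m ℕ.≤ toℕ j → c j < x) → bump c x ≤ x + + m
  bump-≤ {x} below = ℤP.+-monoʳ-≤ x (+≤+ (count-≤ (λ j → x ≤? c j) id
    (λ j m≤j → ℤP.<⇒≱ (below j m≤j))))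

  bump-≥ : ∀ {x m} → m ℕ.≤ n → (∀ j → toℕ j ℕ.< m → x ≤ c j) → x + + m ≤ bump c x
  bump-≥ {x} m≤n above = ℤP.+-monoʳ-≤ x (+≤+ (count-≥ (λ j → x ≤? c j) id m≤n above))

bump-strip : ∀ {n} {c c′ : Fin n → ℤ} → Stepwise _<_ c c′ → Stepwise _<_ c′ c′ →
             ∀ {x y} → x < y → bump c x ≤ bump c′ y
bump-strip c<c′ c′↓ {x} x<y =
  ℤP.≤-trans (bump-≤-bump-suc c<c′ x) (bump-mono c′↓ (ℤP.i<j⇒suc[i]≤j x<y))

bump-ribbon : ∀ {n} {c c′ : Fin n → ℤ} → Stepwise _≤_ c c′ → Stepwise _<_ c′ c′ →
              ∀ {x y} → x ≤ y → bump c x ≤ bump c′ y + 1ℤ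
bump-ribbon c≤c′ c′↓ {x} x≤y =
  ℤP.≤-trans (bump-≤-bump+1 c≤c′ x) (ℤP.+-monoˡ-≤ 1ℤ (bump-mono c′↓ x≤y))

minus-mono-≤ : ∀ {a b c d} → a ℕ.≤ c → d ℕ.≤ b → + a - + b ≤ + c - + d
minus-mono-≤ a≤c d≤b = ℤP.+-mono-≤ (+≤+ a≤c) (ℤP.neg-mono-≤ (+≤+ d≤b))

minus-mono-< : ∀ {a b c d} → a ℕ.≤ c → d ℕ.< b → + a - + b < + c - + d
minus-mono-< a≤c d<b = ℤP.+-mono-≤-< (+≤+ a≤c) (ℤP.neg-mono-< (+<+ d<b))

[1+m]-[1+n]≡m-n : ∀ m n → + suc m - + suc n ≡ + m - + n
[1+m]-[1+n]≡m-n m n = begin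
  + suc m - + suc n  ≡⟨ ℤP.[+m]-[+n]≡m⊖n (suc m) (suc n) ⟩
  suc m ℤ.⊖ suc n    ≡⟨ ℤP.[1+m]⊖[1+n]≡m⊖n m n ⟩
  m ℤ.⊖ n            ≡⟨ ℤP.[+m]-[+n]≡m⊖n m n ⟨
  + m - + n          ∎
  where open ≡-Reasoning

suc[i-[1+n]]≡i-n : ∀ i n → sucℤ (i - + suc n) ≡ i - + n
suc[i-[1+n]]≡i-n i n = trans (cong sucℤ (ℤP.minus-suc i n)) (ℤP.suc-pred (i - + n))

module _ {n : ℕ} where

  shifted-strictlyDecreasing : {μ : Tuple n} → IsPartition μ → Stepwise _<_ (shifted μ) (shifted μ)
  shifted-strictlyDecreasing μ↓ i j j≡1+i =
    minus-mono-< (μ↓ i j (ℕP.<⇒≤ i<j)) (s≤s i<j)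
    where i<j = ℕP.≤-reflexive (sym j≡1+i)

  shifted-strip : {μ α : Tuple n} → HorizontalStrip μ α → Stepwise _<_ (shifted μ) (shifted α)
  shifted-strip strip i j j≡1+i =
    minus-mono-< (strip i j j≡1+i) (s≤s (ℕP.≤-reflexive (sym j≡1+i)))

  shifted-ribbon : {μ α : Tuple n} → WeakRibbon μ α → Stepwise _≤_ (shifted μ) (shifted α)
  shifted-ribbon {μ} {α} ribbon i j j≡1+i = begin
    + μ j - + suc (toℕ j)        ≤⟨ minus-mono-≤ (ribbon i j j≡1+i) (ℕP.≤-refl {suc (toℕ j)}) ⟩
    + suc (α i) - + suc (toℕ j)  ≡⟨ [1+m]-[1+n]≡m-n (α i) (toℕ j) ⟩
    + α i - + toℕ j              ≡⟨ cong (λ k → + α i - + k) j≡1+i ⟩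
    shifted α i                  ∎
    where open ℤP.≤-Reasoning

rho-as-bump : ∀ {n} (μ ν : Tuple n) j → rho μ ν j ≡ bump (shifted μ) (sucℤ (shifted ν j))
rho-as-bump μ ν j = cong₂ (λ y k → y + + k) (ℤP.+-comm (shifted ν j) 1ℤ)
  (cong length (filter-≐ (λ k → shifted ν j <? shifted μ k)
                         (λ k → sucℤ (shifted ν j) ≤? shifted μ k)
                         (ℤP.i<j⇒suc[i]≤j , ℤP.suc[i]≤j⇒i<j) (tabulate id)))

module _ {n : ℕ} {τ : Tuple n} where

  hook-≤1 : IsPartition τ → IsHook τ → ∀ {k} → 1 ℕ.≤ toℕ k → τ k ℕ.≤ 1
  hook-≤1 τ↓ hook {k} 1≤k =
    ℕP.≤-trans (τ↓ second k (ℕP.≤-trans (ℕP.≤-reflexive (toℕ-fromℕ< 1<n)) 1≤k))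
               (hook second (toℕ-fromℕ< 1<n))
    where
    1<n = ℕP.≤-trans (s≤s 1≤k) (toℕ<n k)
    second = fromℕ< 1<n

  hook-shifted-second : IsHook τ → ∀ {i} → toℕ i ≡ 1 → shifted τ i ≤ + 1 - + 2
  hook-shifted-second hook {i} i≡1 = minus-mono-≤ (hook i i≡1) (ℕP.≤-reflexive (cong suc (sym i≡1)))

  hook-shifted-tail : IsPartition τ → IsHook τ → ∀ m → 1 ℕ.≤ m →
                      ∀ k → m ℕ.≤ toℕ k → shifted τ k < + 1 - + m
  hook-shifted-tail τ↓ hook m 1≤m k m≤k =
    minus-mono-< (hook-≤1 τ↓ hook (ℕP.≤-trans 1≤m m≤k)) (s≤s m≤k)

  twoParts-shifted : AtMostTwoParts τ → ∀ {k} → 2 ℕ.≤ toℕ k → shifted τ k ≡ + 0 - + suc (toℕ k)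
  twoParts-shifted twoRows {k} 2≤k = cong (λ a → + a - + suc (toℕ k)) (twoRows k 2≤k)

  bump-twoParts : AtMostTwoParts τ → ∀ {m} → 2 ℕ.≤ m → m ℕ.≤ n →
                  bump (shifted τ) (+ 0 - + m) ≡ + 0
  bump-twoParts twoRows {m} 2≤m m≤n =
    trans (ℤP.≤-antisym (bump-≤ tail) (bump-≥ m≤n head)) (//-rightDividesˡ (+ m) (+ 0))
    where
    tail : ∀ k → m ℕ.≤ toℕ k → shifted τ k < + 0 - + m
    tail k m≤k = minus-mono-< (ℕP.≤-reflexive (twoRows k (ℕP.≤-trans 2≤m m≤k))) (s≤s m≤k)
    head : ∀ k → toℕ k ℕ.< m → + 0 - + m ≤ shifted τ k
    head k k<m = minus-mono-≤ (z≤n {τ k}) k<m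

module _ {n : ℕ} (μ ν : Tuple n) where

  lam-rho-hook : IsPartition μ → IsPartition ν → IsHook μ → IsHook ν →
                 IsHookℤ (lam μ ν) × IsHookℤ (rho μ ν)
  lam-rho-hook μ↓ ν↓ μ-hook ν-hook = lam-hook , rho-hook
    where
    -- μ₂ − 2 ≤ −1 and ν₂ − 2 + 1 ≤ 0, while only the first two values ν_j − j
    -- can reach −1 and only the first value μ_k − k can reach 0.
    lam-hook : IsHookℤ (lam μ ν)
    lam-hook i i≡1 = ℤP.≤-trans
      (bump-mono (shifted-strictlyDecreasing ν↓) (hook-shifted-second μ-hook i≡1))
      (bump-≤ (hook-shifted-tail ν↓ ν-hook 2 (s≤s z≤n)))
    rho-hook : IsHookℤ (rho μ ν)
    rho-hook i i≡1 = subst (_≤ + 1) (sym (rho-as-bump μ ν i)) (ℤP.≤-trans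
      (bump-mono (shifted-strictlyDecreasing μ↓) (ℤP.suc-mono (hook-shifted-second ν-hook i≡1)))
      (bump-≤ (hook-shifted-tail μ↓ μ-hook 1 ℕP.≤-refl)))

  lam-rho-twoParts : AtMostTwoParts μ → AtMostTwoParts ν →
                     AtMostTwoPartsℤ (lam μ ν) × AtMostTwoPartsℤ (rho μ ν)
  lam-rho-twoParts μ-two ν-two = lam-two , rho-two
    where
    lam-two : AtMostTwoPartsℤ (lam μ ν)
    lam-two i 2≤i = trans (cong (bump (shifted ν)) (twoParts-shifted μ-two 2≤i))
      (bump-twoParts ν-two (ℕP.m≤n⇒m≤1+n 2≤i) (toℕ<n i))
    rho-two : AtMostTwoPartsℤ (rho μ ν)
    rho-two j 2≤j = begin
      rho μ ν j                        ≡⟨ rho-as-bump μ ν j ⟩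
      d (sucℤ (shifted ν j))           ≡⟨ cong (d ∘ sucℤ) (twoParts-shifted ν-two 2≤j) ⟩
      d (sucℤ (+ 0 - + suc (toℕ j)))   ≡⟨ cong d (suc[i-[1+n]]≡i-n (+ 0) (toℕ j)) ⟩
      d (+ 0 - + toℕ j)                ≡⟨ bump-twoParts μ-two 2≤j (ℕP.<⇒≤ (toℕ<n j)) ⟩
      + 0                              ∎
      where
      open ≡-Reasoning
      d = bump (shifted μ)

module _ {n : ℕ} (μ ν α β : Tuple n) (α↓ : IsPartition α) (β↓ : IsPartition β) where

  lam-rho-horizontalStrip : HorizontalStrip μ α → HorizontalStrip ν β →
    HorizontalStripℤ (lam μ ν) (lam α β) × HorizontalStripℤ (rho μ ν) (rho α β)
  lam-rho-horizontalStrip μ/α ν/β =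
    (λ i j j≡1+i → bump-strip (shifted-strip ν/β) (shifted-strictlyDecreasing β↓)
      (shifted-strip μ/α i j j≡1+i)) ,
    (λ i j j≡1+i → subst₂ _≤_ (sym (rho-as-bump μ ν j)) (sym (rho-as-bump α β i))
      (bump-strip (shifted-strip μ/α) (shifted-strictlyDecreasing α↓)
        (ℤP.+-monoʳ-< 1ℤ (shifted-strip ν/β i j j≡1+i))))

  lam-rho-weakRibbon : WeakRibbon μ α → WeakRibbon ν β →
    WeakRibbonℤ (lam μ ν) (lam α β) × WeakRibbonℤ (rho μ ν) (rho α β)
  lam-rho-weakRibbon μ/α ν/β =
    (λ i j j≡1+i → bump-ribbon (shifted-ribbon ν/β) (shifted-strictlyDecreasing β↓)
      (shifted-ribbon μ/α i j j≡1+i)) ,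
    (λ i j j≡1+i → subst₂ (λ u v → u ≤ v + 1ℤ) (sym (rho-as-bump μ ν j)) (sym (rho-as-bump α β i))
      (bump-ribbon (shifted-ribbon μ/α) (shifted-strictlyDecreasing α↓)
        (ℤP.suc-mono (shifted-ribbon ν/β i j j≡1+i))))

proposition2p8 :
    (∀ (n : ℕ) (μ ν : Tuple n) → IsPartition μ → IsPartition ν →
       IsHook μ → IsHook ν →
       IsHookℤ (lam μ ν) × IsHookℤ (rho μ ν))
    ×
    (∀ (n : ℕ) (μ ν : Tuple n) → IsPartition μ → IsPartition ν →
       AtMostTwoParts μ → AtMostTwoParts ν →
       AtMostTwoPartsℤ (lam μ ν) × AtMostTwoPartsℤ (rho μ ν))
    ×
    (∀ (n : ℕ) (μ ν α β : Tuple n) →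
       IsPartition μ → IsPartition ν → IsPartition α → IsPartition β →
       α ⊆ₚ μ → β ⊆ₚ ν → HorizontalStrip μ α → HorizontalStrip ν β →
       HorizontalStripℤ (lam μ ν) (lam α β) × HorizontalStripℤ (rho μ ν) (rho α β))
    ×
    (∀ (n : ℕ) (μ ν α β : Tuple n) →
       IsPartition μ → IsPartition ν → IsPartition α → IsPartition β →
       α ⊆ₚ μ → β ⊆ₚ ν → WeakRibbon μ α → WeakRibbon ν β →
       WeakRibbonℤ (lam μ ν) (lam α β) × WeakRibbonℤ (rho μ ν) (rho α β))
proposition2p8 =
  (λ _ → lam-rho-hook) ,
  (λ _ μ ν _ _ → lam-rho-twoParts μ ν) ,
  (λ _ μ ν α β _ _ α↓ β↓ _ _ → lam-rho-horizontalStrip μ ν α β α↓ β↓) ,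
  (λ _ μ ν α β _ _ α↓ β↓ _ _ → lam-rho-weakRibbon μ ν α β α↓ β↓)
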